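{- Let $x_1,\dots,x_n$ be integer variables with finite domains $D(x_1),\dots,D(x_n)\subseteq\mathbb{Z}$, let $\mathcal{D}=D(x_1)\times\cdots\times D(x_n)$, and let $c_i\subseteq\mathcal{D}$ be a constraint. Let $f_i:\mathcal{P}(\mathcal{D})\to\mathcal{P}(\mathcal{D})$, $f_i(S)=\{s\in S\mid c_i(s)\}$, be the exact filtering operator of $c_i$. Let $\mathcal{D}^\sharp_{arc}=\mathcal{P}(D(x_1))\times\cdots\times\mathcal{P}(D(x_n))$, ordered componentwise by inclusion, with $\alpha_{arc}:\mathcal{P}(\mathcal{D})\to\mathcal{D}^\sharp_{arc}$, $\alpha_{arc}(S)=(\{s_1\mid s\in S\},\dots,\{s_n\mid s\in S\})$, and $\gamma_{arc}:\mathcal{D}^\sharp_{arc}\to\mathcal{P}(\mathcal{D})$, $\gamma_{arc}(S_1,\dots,S_n)=S_1\times\cdots\times S_n$. Define $f^\sharp_{i\_arc}=\alpha_{arc}\circ f_i\circ\gamma_{arc}$. Let $p:\mathcal{D}^\sharp_{arc}\to\mathcal{D}^\sharp_{arc}$ be a filtering operator associated with $c_i$. Then $p$ computes domain-consistency if and only if $p=f^\sharp_{i\_arc}$.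
   Context: A filtering operator associated with $c_i$ is a map $p:\mathcal{D}^\sharp_{arc}\to\mathcal{D}^\sharp_{arc}$ such that for every $T=(T_1,\dots,T_n)$: $p(T)$ is componentwise contained in $T$, and $p$ removes no solutions, i.e. every $s\in\gamma_{arc}(T)$ with $c_i(s)$ lies in $\gamma_{arc}(p(T))$. A tuple of domains $(T_1,\dots,T_n)$ is domain-consistent for $c_i$ if for every $k$ and every $d_k\in T_k$ there exist $d_j\in T_j$ ($j\neq k$) such that $(d_1,\dots,d_n)$ satisfies $c_i$. The operator $p$ computes domain-consistency if $p(T)$ is domain-consistent for $c_i$ for every $T\in\mathcal{D}^\sharp_{arc}$. -}

module Defs where

open import Level using (0ℓ)
open import Data.Nat using (ℕ)
open import Data.Fin using (Fin)
open import Data.Integer using (ℤ)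
open import Data.List using (List)
open import Data.List.Membership.Propositional using (_∈_)
open import Data.Product using (Σ; _×_; _,_; proj₁; proj₂; ∃)
open import Relation.Unary using (Pred; _⊆_; _≐_; _∩_)
open import Relation.Binary.PropositionalEquality using (_≡_; _≢_)

module _ {n : ℕ} (D : Fin n → List ℤ) where

  Tuple : Set
  Tuple = Fin n → ℤ

  𝒟 : Pred Tuple 0ℓ
  𝒟 s = ∀ k → s k ∈ D k

  P𝒟 : Set₁
  P𝒟 = Σ (Pred Tuple 0ℓ) (λ S → S ⊆ 𝒟)

  Constraint : Set₁
  Constraint = Σ (Pred Tuple 0ℓ) (λ c → c ⊆ 𝒟)

  Darc : Set₁
  Darc = Σ (Fin n → Pred ℤ 0ℓ) (λ T → ∀ k → T k ⊆ (_∈ D k))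

  exactFilter : Constraint → P𝒟 → P𝒟
  exactFilter (c , _) (S , S⊆) = (S ∩ c) , (λ x → S⊆ (proj₁ x))

  αarc : P𝒟 → Darc
  αarc (S , S⊆) =
    (λ k d → Σ Tuple (λ s → S s × s k ≡ d)) ,
    (λ { k (s , Ss , Relation.Binary.PropositionalEquality.refl) → S⊆ Ss k })

  γarc : Darc → P𝒟
  γarc (T , T⊆) = (λ s → ∀ k → T k (s k)) , (λ Ts k → T⊆ k (Ts k))

  fSharpArc : Constraint → Darc → Darc
  fSharpArc c T = αarc (exactFilter c (γarc T))

  _⊑_ : Darc → Darc → Set
  (T , _) ⊑ (T' , _) = ∀ k → T k ⊆ T' k

  IsFilteringOperator : Constraint → (Darc → Darc) → Set₁
  IsFilteringOperator (c , _) p =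
    (∀ T → p T ⊑ T) ×
    (∀ T s → proj₁ (γarc T) s → c s → proj₁ (γarc (p T)) s)

  DomainConsistent : Constraint → Darc → Set
  DomainConsistent (c , _) (T , _) =
    ∀ k d → T k d →
      Σ Tuple (λ s → s k ≡ d × (∀ j → j ≢ k → T j (s j)) × c s)

  ComputesDomainConsistency : Constraint → (Darc → Darc) → Set₁
  ComputesDomainConsistency c p = ∀ T → DomainConsistent c (p T)

  _≗♯_ : (Darc → Darc) → (Darc → Darc) → Set₁
  p ≗♯ q = ∀ T k → proj₁ (p T) k ≐ proj₁ (q T) k

-- f♯(T) is the smallest box containing every solution of c inside T.  A
-- filtering operator keeps all those solutions, so f♯(T) ⊑ p(T).  Every value
-- of a domain-consistent sub-box of T is a coordinate of a solution inside T,
-- so p(T) ⊑ f♯(T) when p computes domain-consistency.  Conversely f♯(T) is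
-- domain-consistent: each of its values comes with a supporting solution.
module Submission where

open import Defs
open import Data.Nat using (ℕ)
open import Data.Fin using (Fin; _≟_)
open import Data.Integer using (ℤ)
open import Data.List using (List)
open import Data.Product using (_×_; _,_; proj₁; proj₂)
open import Relation.Nullary using (yes; no)
open import Relation.Binary.PropositionalEquality using (refl; sym; subst)

module _ {n : ℕ} (D : Fin n → List ℤ) (c : Constraint D) where

  fSharpArc-⊑-filtering : ∀ {p} → IsFilteringOperator D c p →
                          ∀ T → _⊑_ D (fSharpArc D c T) (p T)
  fSharpArc-⊑-filtering (_ , keep) T k (s , (s∈T , cs) , refl) = keep T s s∈T cs k

  fSharpArc-domainConsistent : ∀ T → DomainConsistent D c (fSharpArc D c T)
  fSharpArc-domainConsistent T k d (s , (s∈T , cs) , sk≡d) =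
    s , sk≡d , (λ j _ → s , (s∈T , cs) , refl) , cs

  domainConsistent-⊑-fSharpArc : ∀ {T U} → _⊑_ D U T → DomainConsistent D c U →
                                 _⊑_ D U (fSharpArc D c T)
  domainConsistent-⊑-fSharpArc {T} {U} U⊑T dc k {d} Ukd with dc k d Ukd
  ... | s , sk≡d , support , cs = s , (s∈T , cs) , sk≡d
    where
    s∈T : ∀ j → proj₁ T j (s j)
    s∈T j with j ≟ k
    ... | yes refl = U⊑T k (subst (proj₁ U k) (sym sk≡d) Ukd)
    ... | no j≢k   = U⊑T j (support j j≢k)

  domainConsistent-resp-⊑ : ∀ {T U} → _⊑_ D T U → _⊑_ D U T →
                            DomainConsistent D c U → DomainConsistent D c T
  domainConsistent-resp-⊑ T⊑U U⊑T dc k d Tkd with dc k d (T⊑U k Tkd)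
  ... | s , sk≡d , support , cs = s , sk≡d , (λ j j≢k → U⊑T j (support j j≢k)) , cs

mainTheorem1 : (n : ℕ) (D : Fin n → List ℤ) (c : Constraint D) (p : Darc D → Darc D)
    → IsFilteringOperator D c p
    → (ComputesDomainConsistency D c p → _≗♯_ D p (fSharpArc D c))
    × (_≗♯_ D p (fSharpArc D c) → ComputesDomainConsistency D c p)
mainTheorem1 n D c p filtering@(p⊑id , _) = consistent⇒exact , exact⇒consistent
  where
  consistent⇒exact : ComputesDomainConsistency D c p → _≗♯_ D p (fSharpArc D c)
  consistent⇒exact dc T k =
    domainConsistent-⊑-fSharpArc D c {T} {p T} (p⊑id T) (dc T) k ,
    fSharpArc-⊑-filtering D c {p} filtering T k

  exact⇒consistent : _≗♯_ D p (fSharpArc D c) → ComputesDomainConsistency D c p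
  exact⇒consistent p≐f T =
    domainConsistent-resp-⊑ D c {p T} {fSharpArc D c T}
      (λ k → proj₁ (p≐f T k)) (λ k → proj₂ (p≐f T k)) (fSharpArc-domainConsistent D c T)
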